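{- For every $t\in\mathbb{Q}\cap[0,1]$, the $q$-Markov number $m^t_q$ is a Laurent polynomial such that (i) all its coefficients are non-negative integers; (ii) it is monic, i.e. its leading (highest-degree) coefficient equals $1$; (iii) it is palindromic: $m^t_{q^{ -1}}=m^t_q$.
   Context: Let $q$ be a formal variable and $[3]_q=q^2+q+1$. Two rationals $\frac{r}{s}<\frac{r'}{s'}$ in $[0,1]$, written in lowest terms with $s,s'>0$, are Farey neighbours if $r's-rs'=1$; every rational in $(0,1)$ is the mediant $\frac{r+r'}{s+s'}$ of exactly one pair of Farey neighbours in $[0,1]$. The $q$-Markov numbers $m^t_q\in\mathbb{Z}[q^{\pm1}]$, for $t\in(\mathbb{Q}\cap[0,1])\cup\{\frac10\}$, are defined recursively by $m^{0/1}_q=1$, $m^{1/1}_q=q+q^{ -1}$, $m^{1/0}_q=1$, and, for Farey neighbours $\frac rs<\frac{r'}{s'}$ in $[0,1]$, $$m_q^{\frac{r+r'}{s+s'}}=q^{ -1}[3]_q\,m_q^{r/s}\,m_q^{r'/s'}-m_q^{\frac{r'-r}{s'-s}},$$ where $\frac{r'-r}{s'-s}$ is understood as the rational number it represents (it is $\frac10$ for the pair $\frac01,\frac11$). -}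

module Defs where

open import Data.Nat as ℕ using (ℕ; zero; suc)
open import Data.Integer as ℤ using (ℤ; +_; -[1+_])
open import Data.List using (List; []; _∷_; map; replicate; _++_)
open import Data.Bool using (Bool; true; false; if_then_else_)
open import Data.Product using (_×_; ∃)
open import Relation.Binary.PropositionalEquality using (_≡_)
open import Relation.Nullary.Decidable using (⌊_⌋)
open import Data.Rational using (ℚ; ↥_; ↧ₙ_)

-- A value  L d cs  with cs = c₀ ∷ c₁ ∷ … ∷ c_k  denotes
--   c₀ q^d + c₁ q^(d+1) + … + c_k q^(d+k).
-- (The representation is not canonical; all properties below are
-- stated through the coefficient function `coeff`, which is.)

record Laurent : Set where
  constructor L
  field
    low : ℤ
    cs  : List ℤ

nth : List ℤ → ℕ → ℤ
nth []       _       = + 0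
nth (c ∷ _)  zero    = c
nth (_ ∷ cs) (suc i) = nth cs i

coeff : Laurent → ℤ → ℤ
coeff (L d cs) n with n ℤ.- d
... | + k      = nth cs k
... | -[1+ _ ] = + 0

addL : List ℤ → List ℤ → List ℤ
addL []       ys       = ys
addL xs       []       = xs
addL (x ∷ xs) (y ∷ ys) = (x ℤ.+ y) ∷ addL xs ys

mulL : List ℤ → List ℤ → List ℤ
mulL []       ys = []
mulL (x ∷ xs) ys = addL (map (x ℤ.*_) ys) (+ 0 ∷ mulL xs ys)

_⊕_ : Laurent → Laurent → Laurent
L d cs ⊕ L e ds =
  L (d ℤ.⊓ e)
    (addL (replicate ℤ.∣ d ℤ.- (d ℤ.⊓ e) ∣ (+ 0) ++ cs)
          (replicate ℤ.∣ e ℤ.- (d ℤ.⊓ e) ∣ (+ 0) ++ ds))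

⊖_ : Laurent → Laurent
⊖ L d cs = L d (map ℤ.-_ cs)

_⊗_ : Laurent → Laurent → Laurent
L d cs ⊗ L e ds = L (d ℤ.+ e) (mulL cs ds)

oneL : Laurent
oneL = L (+ 0) (+ 1 ∷ [])

qPlusQinv : Laurent
qPlusQinv = L (-[1+ 0 ]) (+ 1 ∷ + 0 ∷ + 1 ∷ [])

q⁻¹[3] : Laurent
q⁻¹[3] = L (-[1+ 0 ]) (+ 1 ∷ + 1 ∷ + 1 ∷ [])

-- the recursion step  q⁻¹[3]_q · m_{r/s} · m_{r'/s'} − m_{(r'−r)/(s'−s)}
step : Laurent → Laurent → Laurent → Laurent
step ml mr md = ((q⁻¹[3] ⊗ ml) ⊗ mr) ⊕ (⊖ md)

-- q-Markov numbers, computed by descending the Farey (Stern–Brocot)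
-- tree of [0,1] towards the target a/b (in lowest terms).
-- State: Farey neighbours r/s < r'/s' with values ml = m^{r/s},
-- mr = m^{r'/s'}, md = m^{(r'-r)/(s'-s)}.  The mediant is
-- (r+r')/(s+s') with value  step ml mr md.
--   * go left  : neighbours r/s < mediant, whose difference rational is r'/s'
--   * go right : neighbours mediant < r'/s', whose difference rational is r/s
-- The fuel only ensures structural termination: each step increases the
-- mediant's denominator, so fuel = b always suffices.

go : ℕ → (a b : ℕ) → (r s r' s' : ℕ) → (ml mr md : Laurent) → Laurent
go zero    a b r s r' s' ml mr md = oneL   -- unreachable with enough fuel
go (suc f) a b r s r' s' ml mr md =
  let mm  = step ml mr md
      lhs = a ℕ.* (s ℕ.+ s')
      rhs = b ℕ.* (r ℕ.+ r')
  in if ⌊ lhs ℕ.≟ rhs ⌋ then mm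
     else if ⌊ lhs ℕ.<? rhs ⌋
          then go f a b r s (r ℕ.+ r') (s ℕ.+ s') ml mm mr
          else go f a b (r ℕ.+ r') (s ℕ.+ s') r' s' mm mr ml

-- m^t_q for t = a/b in lowest terms with 0 ≤ a ≤ b
markovℕ : (a b : ℕ) → Laurent
markovℕ zero b = oneL
markovℕ a    b =
  if ⌊ a ℕ.≟ b ⌋ then qPlusQinv
  else go b a b 0 1 1 1 oneL qPlusQinv oneL             -- start: 0/1 < 1/1, diff 1/0 (m = 1)

-- m^t_q for t ∈ ℚ (meaningful for t ∈ [0,1]; negative t gives junk)
qMarkov : ℚ → Laurent
qMarkov t with ↥ t
... | + a      = markovℕ a (↧ₙ t)
... | -[1+ _ ] = oneL

NonNegCoeffs : Laurent → Set
NonNegCoeffs p = ∀ (n : ℤ) → + 0 ℤ.≤ coeff p n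

Monic : Laurent → Set
Monic p = ∃ λ (N : ℤ) → coeff p N ≡ + 1 × (∀ (n : ℤ) → N ℤ.< n → coeff p n ≡ + 0)

Palindromic : Laurent → Set
Palindromic p = ∀ (n : ℤ) → coeff p (ℤ.- n) ≡ coeff p n

module Submission where

open import Defs
open import Data.Bool using (true; false; if_then_else_)
open import Data.Empty using (⊥-elim)
open import Data.Fin as Fin using (Fin; toℕ; opposite)
import Data.Fin.Permutation as Perm
import Data.Fin.Properties as FinP
open import Data.Integer as ℤ using (ℤ; +_; -[1+_]; 0ℤ; 1ℤ; _+_; _-_; _*_; -_; ∣_∣)
import Data.Integer.Properties as ℤP
open import Algebra.Properties.CommutativeMonoid.Sum ℤP.+-0-commutativeMonoid
  using (sum; sum-cong-≗; sum-replicate-zero; ∑-distrib-+; sum-remove; sum-permute)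
open import Data.Integer.Tactic.RingSolver using (solve-∀)
open import Data.List using (List; []; _∷_; map; replicate; _++_; length)
open import Data.List.Relation.Unary.All using (All; []; _∷_)
open import Data.Nat as ℕ using (ℕ; zero; suc; z≤n; s≤s)
import Data.Nat.Properties as ℕP
open import Data.Product using (∃; _×_; _,_; proj₁; proj₂)
open import Data.Rational using (ℚ; 0ℚ; 1ℚ; _≤_; ↥_; ↧ₙ_)
open import Data.Sum using (_⊎_; inj₁; inj₂)
open import Data.Vec.Functional using (Vector; removeAt)
open import Function using (_∘_)
open import Relation.Binary.Definitions using (tri<; tri≈; tri>)
open import Relation.Binary.PropositionalEquality
  using (_≡_; _≢_; refl; sym; trans; cong; cong₂; subst; subst₂; module ≡-Reasoning)
open import Relation.Nullary using (yes; no)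
open import Relation.Nullary.Decidable using (⌊_⌋)

-- Along the descent of the Farey tree, every triple (mₗ, mᵣ, m_d) met by `go` satisfies:
-- mₗ and mᵣ have non-negative coefficients and are monic and palindromic, m_d has
-- non-negative coefficients and is palindromic, and m_d ≤ (1 + q⁻¹) mₗ mᵣ coefficientwise.
-- Splitting q⁻¹[3]_q = (1 + q⁻¹) + q, the mediant m = q⁻¹[3]_q mₗ mᵣ − m_d is then
-- ≥ q mₗ mᵣ ≥ 0; it is palindromic; and it is monic of degree 1 + deg mₗ + deg mᵣ, because
-- m_d is squeezed below (1 + q⁻¹) mₗ mᵣ, of degree deg mₗ + deg mᵣ. The bound passes to
-- both children (mₗ, m, mᵣ) and (m, mᵣ, mₗ): a monic palindromic p has coefficient 1 at
-- both q^(deg p) and q^(−deg p), so p² has constant term ≥ 1, and e.g.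
-- (1 + q⁻¹) mₗ m ≥ q⁻¹ mₗ · q mₗ mᵣ = mₗ² mᵣ ≥ mᵣ.

infix 4 _≼_

_≼_ : Laurent → Laurent → Set
P ≼ Q = ∀ n → coeff P n ℤ.≤ coeff Q n

DegreeAtMost : Laurent → ℤ → Set
DegreeAtMost p N = ∀ n → N ℤ.< n → coeff p n ≡ 0ℤ

MonicOfDegree : Laurent → ℤ → Set
MonicOfDegree p N = coeff p N ≡ 1ℤ × DegreeAtMost p N

nthℤ : List ℤ → ℤ → ℤ
nthℤ cs (+ k)    = nth cs k
nthℤ cs -[1+ _ ] = 0ℤ

coeff-L : ∀ d cs n → coeff (L d cs) n ≡ nthℤ cs (n - d)
coeff-L d cs n with n - d
... | + k      = refl
... | -[1+ _ ] = refl

nthℤ-[] : ∀ i → nthℤ [] i ≡ 0ℤ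
nthℤ-[] (+ _)    = refl
nthℤ-[] -[1+ _ ] = refl

nthℤ-∷ : ∀ c cs i → nthℤ (c ∷ cs) i ≡ nthℤ (c ∷ []) i + nthℤ cs (i - 1ℤ)
nthℤ-∷ c cs (+ zero)  = sym (ℤP.+-identityʳ c)
nthℤ-∷ c cs (+ suc k) = sym (ℤP.+-identityˡ (nth cs k))
nthℤ-∷ c cs -[1+ _ ]  = refl

nthℤ-0∷ : ∀ cs i → nthℤ (0ℤ ∷ cs) i ≡ nthℤ cs (i - 1ℤ)
nthℤ-0∷ cs (+ zero)  = refl
nthℤ-0∷ cs (+ suc _) = refl
nthℤ-0∷ cs -[1+ _ ]  = refl

nthℤ-padded : ∀ k cs i → nthℤ (replicate k 0ℤ ++ cs) i ≡ nthℤ cs (i - + k)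
nthℤ-padded zero    cs i = cong (nthℤ cs) (sym (ℤP.+-identityʳ i))
nthℤ-padded (suc k) cs i = begin
  nthℤ (0ℤ ∷ replicate k 0ℤ ++ cs) i    ≡⟨ nthℤ-0∷ (replicate k 0ℤ ++ cs) i ⟩
  nthℤ (replicate k 0ℤ ++ cs) (i - 1ℤ)  ≡⟨ nthℤ-padded k cs (i - 1ℤ) ⟩
  nthℤ cs (i - 1ℤ - + k)                ≡⟨ cong (nthℤ cs) (shift i (+ k)) ⟩
  nthℤ cs (i - + suc k)                 ∎
  where
  open ≡-Reasoning
  shift : ∀ i k → i - 1ℤ - k ≡ i - (1ℤ + k)
  shift = solve-∀

nthℤ-addL : ∀ cs ds i → nthℤ (addL cs ds) i ≡ nthℤ cs i + nthℤ ds i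
nthℤ-addL cs ds -[1+ _ ] = refl
nthℤ-addL cs ds (+ k)    = nth-addL cs ds k
  where
  nth-addL : ∀ cs ds k → nth (addL cs ds) k ≡ nth cs k + nth ds k
  nth-addL []       ds       k       = sym (ℤP.+-identityˡ (nth ds k))
  nth-addL (c ∷ cs) []       k       = sym (ℤP.+-identityʳ (nth (c ∷ cs) k))
  nth-addL (c ∷ cs) (d ∷ ds) zero    = refl
  nth-addL (c ∷ cs) (d ∷ ds) (suc k) = nth-addL cs ds k

nthℤ-map : ∀ (f : ℤ → ℤ) → f 0ℤ ≡ 0ℤ → ∀ cs i → nthℤ (map f cs) i ≡ f (nthℤ cs i)
nthℤ-map f f0≡0 cs -[1+ _ ] = sym f0≡0
nthℤ-map f f0≡0 cs (+ k)    = nth-map cs k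
  where
  nth-map : ∀ cs k → nth (map f cs) k ≡ f (nth cs k)
  nth-map []       k       = sym f0≡0
  nth-map (c ∷ cs) zero    = refl
  nth-map (c ∷ cs) (suc k) = nth-map cs k

nthℤ-≥length : ∀ cs i → + length cs ℤ.≤ i → nthℤ cs i ≡ 0ℤ
nthℤ-≥length cs (+ k) (ℤ.+≤+ len≤k) = nth-≥length cs k len≤k
  where
  nth-≥length : ∀ cs k → length cs ℕ.≤ k → nth cs k ≡ 0ℤ
  nth-≥length []       k       _           = refl
  nth-≥length (c ∷ cs) (suc k) (s≤s len≤k) = nth-≥length cs k len≤k

coeff-⊕ : ∀ P Q n → coeff (P ⊕ Q) n ≡ coeff P n + coeff Q n
coeff-⊕ (L d cs) (L e ds) n = begin
  coeff (L d cs ⊕ L e ds) n                             ≡⟨ coeff-L d⊓e _ n ⟩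
  nthℤ (addL (padded d cs) (padded e ds)) (n - d⊓e)     ≡⟨ nthℤ-addL (padded d cs) (padded e ds) (n - d⊓e) ⟩
  nthℤ (padded d cs) (n - d⊓e) + nthℤ (padded e ds) (n - d⊓e)
    ≡⟨ cong₂ _+_ (unpad d cs (ℤP.i⊓j≤i d e)) (unpad e ds (ℤP.i⊓j≤j d e)) ⟩
  coeff (L d cs) n + coeff (L e ds) n                   ∎
  where
  open ≡-Reasoning
  d⊓e = d ℤ.⊓ e
  padded : ℤ → List ℤ → List ℤ
  padded d cs = replicate ∣ d - d⊓e ∣ 0ℤ ++ cs
  shift : ∀ n m d → n - m - (d - m) ≡ n - d
  shift = solve-∀
  unpad : ∀ d cs → d⊓e ℤ.≤ d → nthℤ (padded d cs) (n - d⊓e) ≡ coeff (L d cs) n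
  unpad d cs d⊓e≤d = begin
    nthℤ (padded d cs) (n - d⊓e)          ≡⟨ nthℤ-padded ∣ d - d⊓e ∣ cs (n - d⊓e) ⟩
    nthℤ cs (n - d⊓e - + ∣ d - d⊓e ∣)     ≡⟨ cong (λ k → nthℤ cs (n - d⊓e - k)) ∣d-d⊓e∣≡d-d⊓e ⟩
    nthℤ cs (n - d⊓e - (d - d⊓e))         ≡⟨ cong (nthℤ cs) (shift n d⊓e d) ⟩
    nthℤ cs (n - d)                       ≡⟨ coeff-L d cs n ⟨
    coeff (L d cs) n                      ∎
    where
    ∣d-d⊓e∣≡d-d⊓e : + ∣ d - d⊓e ∣ ≡ d - d⊓e
    ∣d-d⊓e∣≡d-d⊓e = ℤP.0≤i⇒+∣i∣≡i (ℤP.i≤j⇒0≤j-i d⊓e≤d)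

coeff-⊖ : ∀ P n → coeff (⊖ P) n ≡ - coeff P n
coeff-⊖ (L d cs) n = begin
  coeff (L d (map -_ cs)) n  ≡⟨ coeff-L d (map -_ cs) n ⟩
  nthℤ (map -_ cs) (n - d)   ≡⟨ nthℤ-map -_ refl cs (n - d) ⟩
  - nthℤ cs (n - d)          ≡⟨ cong -_ (coeff-L d cs n) ⟨
  - coeff (L d cs) n         ∎
  where open ≡-Reasoning

coeff-⊕⊖ : ∀ P D n → coeff (P ⊕ (⊖ D)) n ≡ coeff P n - coeff D n
coeff-⊕⊖ P D n = trans (coeff-⊕ P (⊖ D) n) (cong (λ t → coeff P n + t) (coeff-⊖ D n))

coeff-[] : ∀ d n → coeff (L d []) n ≡ 0ℤ
coeff-[] d n = trans (coeff-L d [] n) (nthℤ-[] (n - d))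

coeff-∷ : ∀ d c cs i → coeff (L d (c ∷ cs)) i ≡ coeff (L d (c ∷ [])) i + coeff (L (1ℤ + d) cs) i
coeff-∷ d c cs i = begin
  coeff (L d (c ∷ cs)) i                             ≡⟨ coeff-L d (c ∷ cs) i ⟩
  nthℤ (c ∷ cs) (i - d)                              ≡⟨ nthℤ-∷ c cs (i - d) ⟩
  nthℤ (c ∷ []) (i - d) + nthℤ cs (i - d - 1ℤ)
    ≡⟨ cong₂ _+_ (coeff-L d (c ∷ []) i) (trans (coeff-L (1ℤ + d) cs i) (cong (nthℤ cs) (shift i d))) ⟨
  coeff (L d (c ∷ [])) i + coeff (L (1ℤ + d) cs) i   ∎
  where
  open ≡-Reasoning
  shift : ∀ i d → i - (1ℤ + d) ≡ i - d - 1ℤ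
  shift = solve-∀

coeff-monomial : ∀ d c → coeff (L d (c ∷ [])) d ≡ c
coeff-monomial d c = trans (coeff-L d (c ∷ []) d) (cong (nthℤ (c ∷ [])) (ℤP.+-inverseʳ d))

coeff-monomial-≢ : ∀ d c i → i ≢ d → coeff (L d (c ∷ [])) i ≡ 0ℤ
coeff-monomial-≢ d c i i≢d = trans (coeff-L d (c ∷ []) i) (off-centre (i - d) (i≢d ∘ ℤP.i-j≡0⇒i≡j i d))
  where
  off-centre : ∀ k → k ≢ 0ℤ → nthℤ (c ∷ []) k ≡ 0ℤ
  off-centre (+ zero)  k≢0 = ⊥-elim (k≢0 refl)
  off-centre (+ suc _) _   = refl
  off-centre -[1+ _ ]  _   = refl

coeff-∷-⊗ : ∀ d c cs Y n → coeff (L d (c ∷ cs) ⊗ Y) n ≡ c * coeff Y (n - d) + coeff (L (1ℤ + d) cs ⊗ Y) n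
coeff-∷-⊗ d c cs (L e ds) n = begin
  coeff (L (d + e) (addL (map (c *_) ds) (0ℤ ∷ mulL cs ds))) n
    ≡⟨ coeff-L (d + e) _ n ⟩
  nthℤ (addL (map (c *_) ds) (0ℤ ∷ mulL cs ds)) (n - (d + e))
    ≡⟨ nthℤ-addL (map (c *_) ds) (0ℤ ∷ mulL cs ds) (n - (d + e)) ⟩
  nthℤ (map (c *_) ds) (n - (d + e)) + nthℤ (0ℤ ∷ mulL cs ds) (n - (d + e))
    ≡⟨ cong₂ _+_ (nthℤ-map (c *_) (ℤP.*-zeroʳ c) ds (n - (d + e))) (nthℤ-0∷ (mulL cs ds) (n - (d + e))) ⟩
  c * nthℤ ds (n - (d + e)) + nthℤ (mulL cs ds) (n - (d + e) - 1ℤ)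
    ≡⟨ cong₂ (λ j k → c * nthℤ ds j + nthℤ (mulL cs ds) k) (shift₁ n d e) (shift₂ n d e) ⟩
  c * nthℤ ds (n - d - e) + nthℤ (mulL cs ds) (n - (1ℤ + d + e))
    ≡⟨ cong₂ (λ u v → c * u + v) (coeff-L e ds (n - d)) (coeff-L (1ℤ + d + e) (mulL cs ds) n) ⟨
  c * coeff (L e ds) (n - d) + coeff (L (1ℤ + d) cs ⊗ L e ds) n
    ∎
  where
  open ≡-Reasoning
  shift₁ : ∀ n d e → n - (d + e) ≡ n - d - e
  shift₁ = solve-∀
  shift₂ : ∀ n d e → n - (d + e) - 1ℤ ≡ n - (1ℤ + d + e)
  shift₂ = solve-∀

coeff-≥high : ∀ d cs i → d + + length cs ℤ.≤ i → coeff (L d cs) i ≡ 0ℤ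
coeff-≥high d cs i high≤i = trans (coeff-L d cs i) (nthℤ-≥length cs (i - d) len≤i-d)
  where
  cancel : ∀ d k → d + k - d ≡ k
  cancel = solve-∀
  len≤i-d : + length cs ℤ.≤ i - d
  len≤i-d = subst (ℤ._≤ i - d) (cancel d (+ length cs)) (ℤP.+-monoˡ-≤ (- d) high≤i)

radius : Laurent → ℕ
radius (L d cs) = ∣ d ∣ ℕ.+ length cs

radius-tail : ∀ d c cs → radius (L (1ℤ + d) cs) ℕ.≤ radius (L d (c ∷ cs))
radius-tail d c cs = begin
  ∣ 1ℤ + d ∣ ℕ.+ length cs    ≤⟨ ℕP.+-monoˡ-≤ (length cs) (ℤP.∣i+j∣≤∣i∣+∣j∣ 1ℤ d) ⟩
  suc ∣ d ∣ ℕ.+ length cs     ≡⟨ ℕP.+-suc ∣ d ∣ (length cs) ⟨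
  ∣ d ∣ ℕ.+ suc (length cs)   ∎
  where open ℕP.≤-Reasoning

coeff-support : ∀ X i → coeff X i ≢ 0ℤ → ∣ i ∣ ℕ.≤ radius X
coeff-support (L d cs) = support d cs
  where
  support : ∀ d cs i → coeff (L d cs) i ≢ 0ℤ → ∣ i ∣ ℕ.≤ radius (L d cs)
  support d []       i Xi≢0 = ⊥-elim (Xi≢0 (coeff-[] d i))
  support d (c ∷ cs) i Xi≢0 with i ℤP.≟ d
  ... | yes refl = ℕP.m≤m+n ∣ i ∣ (suc (length cs))
  ... | no  i≢d  = ℕP.≤-trans (support (1ℤ + d) cs i tail≢0) (radius-tail d c cs)
    where
    tail≢0 : coeff (L (1ℤ + d) cs) i ≢ 0ℤ
    tail≢0 tail≡0 = Xi≢0 (trans (coeff-∷ d c cs i) (cong₂ _+_ (coeff-monomial-≢ d c i i≢d) tail≡0))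

∑-mono-≤ : ∀ {n} {f g : Vector ℤ n} → (∀ k → f k ℤ.≤ g k) → sum f ℤ.≤ sum g
∑-mono-≤ {zero}  _   = ℤP.≤-refl
∑-mono-≤ {suc n} f≤g = ℤP.+-mono-≤ (f≤g Fin.zero) (∑-mono-≤ (f≤g ∘ Fin.suc))

∑-zero : ∀ {n} {f : Vector ℤ n} → (∀ k → f k ≡ 0ℤ) → sum f ≡ 0ℤ
∑-zero {n} f≡0 = trans (sum-cong-≗ f≡0) (sum-replicate-zero n)

∑-nonneg : ∀ {n} {f : Vector ℤ n} → (∀ k → 0ℤ ℤ.≤ f k) → 0ℤ ℤ.≤ sum f
∑-nonneg {n} {f} 0≤f = subst (ℤ._≤ sum f) (sum-replicate-zero n) (∑-mono-≤ 0≤f)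

∑-single : ∀ {n} {f : Vector ℤ (suc n)} j → (∀ k → k ≢ j → f k ≡ 0ℤ) → sum f ≡ f j
∑-single {f = f} j others≡0 = begin
  sum f                     ≡⟨ sum-remove {i = j} f ⟩
  f j + sum (removeAt f j)  ≡⟨ cong (λ t → f j + t) (∑-zero (λ k → others≡0 _ (FinP.punchInᵢ≢i j k))) ⟩
  f j + 0ℤ                  ≡⟨ ℤP.+-identityʳ (f j) ⟩
  f j                       ∎
  where open ≡-Reasoning

term≤∑ : ∀ {n} {f : Vector ℤ (suc n)} j → (∀ k → 0ℤ ℤ.≤ f k) → f j ℤ.≤ sum f
term≤∑ {f = f} j 0≤f = begin
  f j                       ≡⟨ ℤP.+-identityʳ (f j) ⟨
  f j + 0ℤ                  ≤⟨ ℤP.+-monoʳ-≤ (f j) (∑-nonneg (0≤f ∘ Fin.punchIn j)) ⟩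
  f j + sum (removeAt f j)  ≡⟨ sum-remove {i = j} f ⟨
  sum f                     ∎
  where open ℤP.≤-Reasoning

Window : ℕ → Set
Window B = Fin (suc (B ℕ.+ B))

window : ∀ B → Window B → ℤ
window B j = + toℕ j - + B

window-injective : ∀ B {j k} → window B j ≡ window B k → j ≡ k
window-injective B {j} {k} wj≡wk = FinP.toℕ-injective (ℤP.+-injective (begin
  + toℕ j                  ≡⟨ cancel (+ toℕ j) (+ B) ⟨
  window B j + + B         ≡⟨ cong (_+ + B) wj≡wk ⟩
  window B k + + B         ≡⟨ cancel (+ toℕ k) (+ B) ⟩
  + toℕ k                  ∎))
  where
  open ≡-Reasoning
  cancel : ∀ i b → i - b + b ≡ i
  cancel = solve-∀

window-opposite : ∀ B j → window B (opposite j) ≡ - window B j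
window-opposite B j = begin
  + toℕ (opposite j) - + B       ≡⟨ cong (λ k → + k - + B) (FinP.opposite-prop j) ⟩
  + (B ℕ.+ B ℕ.∸ toℕ j) - + B    ≡⟨ cong (_- + B) 2B-j≡2B∸j ⟨
  + (B ℕ.+ B) - + toℕ j - + B    ≡⟨ cong (λ k → k - + toℕ j - + B) (ℤP.pos-+ B B) ⟩
  + B + + B - + toℕ j - + B      ≡⟨ reflect (+ B) (+ toℕ j) ⟩
  - (+ toℕ j - + B)              ∎
  where
  open ≡-Reasoning
  j≤2B : toℕ j ℕ.≤ B ℕ.+ B
  j≤2B = ℕ.s≤s⁻¹ (FinP.toℕ<n j)
  2B-j≡2B∸j : + (B ℕ.+ B) - + toℕ j ≡ + (B ℕ.+ B ℕ.∸ toℕ j)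
  2B-j≡2B∸j = trans (ℤP.m-n≡m⊖n (B ℕ.+ B) (toℕ j)) (ℤP.⊖-≥ j≤2B)
  reflect : ∀ b k → b + b - k - b ≡ - (k - b)
  reflect = solve-∀

window-surjective : ∀ B i → ∣ i ∣ ℕ.≤ B → ∃ λ j → window B j ≡ i
window-surjective B i ∣i∣≤B = Fin.fromℕ< k<2B+1 , (begin
  + toℕ (Fin.fromℕ< k<2B+1) - + B  ≡⟨ cong (λ k → + k - + B) (FinP.toℕ-fromℕ< k<2B+1) ⟩
  + ∣ i + + B ∣ - + B              ≡⟨ cong (_- + B) (ℤP.0≤i⇒+∣i∣≡i 0≤i+B) ⟩
  i + + B - + B                    ≡⟨ cancel i (+ B) ⟩
  i                                ∎)
  where
  open ≡-Reasoning
  cancel : ∀ i b → i + b - b ≡ i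
  cancel = solve-∀
  -B≤i : ∀ i → ∣ i ∣ ℕ.≤ B → - + B ℤ.≤ i
  -B≤i (+ _)    _         = ℤP.neg-≤-pos
  -B≤i -[1+ n ] (s≤s n<B) = ℤ.-≤- n<B
  0≤i+B : 0ℤ ℤ.≤ i + + B
  0≤i+B = subst (ℤ._≤ i + + B) (ℤP.+-inverseˡ (+ B)) (ℤP.+-monoˡ-≤ (+ B) (-B≤i i ∣i∣≤B))
  k<2B+1 : ∣ i + + B ∣ ℕ.< suc (B ℕ.+ B)
  k<2B+1 = s≤s (ℕP.≤-trans (ℤP.∣i+j∣≤∣i∣+∣j∣ i (+ B)) (ℕP.+-monoˡ-≤ B ∣i∣≤B))

-- The list representation of a Laurent polynomial is not canonical, so products are
-- studied through this convolution of coefficient functions over the exponents −B, …, B.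
conv : ℕ → (ℤ → ℤ) → (ℤ → ℤ) → ℤ → ℤ
conv B f g n = sum (λ j → f (window B j) * g (n - window B j))

conv-cong : ∀ B {f f′ g g′ : ℤ → ℤ} n → (∀ i → f i ≡ f′ i) → (∀ i → g i ≡ g′ i) →
            conv B f g n ≡ conv B f′ g′ n
conv-cong B n f≗f′ g≗g′ = sum-cong-≗ (λ j → cong₂ _*_ (f≗f′ (window B j)) (g≗g′ (n - window B j)))

conv-distribˡ : ∀ B (f f₁ f₂ g : ℤ → ℤ) n → (∀ i → f i ≡ f₁ i + f₂ i) →
                conv B f g n ≡ conv B f₁ g n + conv B f₂ g n
conv-distribˡ B f f₁ f₂ g n f≡f₁+f₂ =
  trans (sum-cong-≗ split) (∑-distrib-+ (λ j → f₁ (w j) * g (n - w j)) (λ j → f₂ (w j) * g (n - w j)))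
  where
  w = window B
  split : ∀ j → f (w j) * g (n - w j) ≡ f₁ (w j) * g (n - w j) + f₂ (w j) * g (n - w j)
  split j = trans (cong (_* g (n - w j)) (f≡f₁+f₂ (w j))) (ℤP.*-distribʳ-+ (g (n - w j)) (f₁ (w j)) (f₂ (w j)))

conv-zero : ∀ B (f g : ℤ → ℤ) n → (∀ i → f i * g (n - i) ≡ 0ℤ) → conv B f g n ≡ 0ℤ
conv-zero B f g n terms≡0 = ∑-zero (terms≡0 ∘ window B)

conv-single : ∀ B (f g : ℤ → ℤ) n a → ∣ a ∣ ℕ.≤ B → (∀ i → i ≢ a → f i * g (n - i) ≡ 0ℤ) →
              conv B f g n ≡ f a * g (n - a)
conv-single B f g n a ∣a∣≤B others≡0 with window-surjective B a ∣a∣≤B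
... | j , refl = ∑-single j (λ k k≢j → others≡0 (window B k) (k≢j ∘ window-injective B))

conv-mono-≤ : ∀ B (f f′ g g′ : ℤ → ℤ) n → (∀ i → f i * g (n - i) ℤ.≤ f′ i * g′ (n - i)) →
              conv B f g n ℤ.≤ conv B f′ g′ n
conv-mono-≤ B f f′ g g′ n terms≤ = ∑-mono-≤ (terms≤ ∘ window B)

conv-nonneg : ∀ B (f g : ℤ → ℤ) n → (∀ i → 0ℤ ℤ.≤ f i * g (n - i)) → 0ℤ ℤ.≤ conv B f g n
conv-nonneg B f g n 0≤terms = ∑-nonneg (0≤terms ∘ window B)

term≤conv : ∀ B (f g : ℤ → ℤ) n a → ∣ a ∣ ℕ.≤ B → (∀ i → 0ℤ ℤ.≤ f i * g (n - i)) →
            f a * g (n - a) ℤ.≤ conv B f g n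
term≤conv B f g n a ∣a∣≤B 0≤terms with window-surjective B a ∣a∣≤B
... | j , refl = term≤∑ j (0≤terms ∘ window B)

conv-reflect : ∀ B (f g : ℤ → ℤ) n → conv B f g (- n) ≡ conv B (f ∘ -_) (g ∘ -_) n
conv-reflect B f g n = trans (sum-permute (λ j → f (w j) * g (- n - w j)) Perm.reverse) (sum-cong-≗ reflected)
  where
  w = window B
  flip : ∀ n i → - n - - i ≡ - (n - i)
  flip = solve-∀
  reflected : ∀ j → f (w (opposite j)) * g (- n - w (opposite j)) ≡ f (- w j) * g (- (n - w j))
  reflected j = trans (cong (λ i → f i * g (- n - i)) (window-opposite B j))
                      (cong (λ k → f (- w j) * g k) (flip n (w j)))

coeff-⊗ : ∀ X Y {B} → radius X ℕ.≤ B → ∀ n → coeff (X ⊗ Y) n ≡ conv B (coeff X) (coeff Y) n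
coeff-⊗ (L d cs) (L e ds) = coeff-L-⊗ d cs
  where
  Y = L e ds
  coeff-L-⊗ : ∀ d cs {B} → radius (L d cs) ℕ.≤ B → ∀ n →
              coeff (L d cs ⊗ Y) n ≡ conv B (coeff (L d cs)) (coeff Y) n
  coeff-L-⊗ d [] {B} _ n =
    trans (coeff-[] (d + e) n)
          (sym (conv-zero B (coeff (L d [])) (coeff Y) n (λ i → cong (_* coeff Y (n - i)) (coeff-[] d i))))
  coeff-L-⊗ d (c ∷ cs) {B} r≤B n = begin
    coeff (L d (c ∷ cs) ⊗ Y) n
      ≡⟨ coeff-∷-⊗ d c cs Y n ⟩
    c * coeff Y (n - d) + coeff (L (1ℤ + d) cs ⊗ Y) n
      ≡⟨ cong₂ _+_ head (coeff-L-⊗ (1ℤ + d) cs (ℕP.≤-trans (radius-tail d c cs) r≤B) n) ⟩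
    conv B (coeff (L d (c ∷ []))) (coeff Y) n + conv B (coeff (L (1ℤ + d) cs)) (coeff Y) n
      ≡⟨ conv-distribˡ B (coeff (L d (c ∷ cs))) (coeff (L d (c ∷ []))) (coeff (L (1ℤ + d) cs)) (coeff Y) n
                      (coeff-∷ d c cs) ⟨
    conv B (coeff (L d (c ∷ cs))) (coeff Y) n
      ∎
    where
    open ≡-Reasoning
    ∣d∣≤B : ∣ d ∣ ℕ.≤ B
    ∣d∣≤B = ℕP.≤-trans (ℕP.m≤m+n ∣ d ∣ (suc (length cs))) r≤B
    head : c * coeff Y (n - d) ≡ conv B (coeff (L d (c ∷ []))) (coeff Y) n
    head = sym (trans
      (conv-single B (coeff (L d (c ∷ []))) (coeff Y) n d ∣d∣≤B
        (λ i i≢d → cong (_* coeff Y (n - i)) (coeff-monomial-≢ d c i i≢d)))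
      (cong (_* coeff Y (n - d)) (coeff-monomial d c)))

*-monoʳ-≤ : ∀ {a a′ b} → 0ℤ ℤ.≤ b → a ℤ.≤ a′ → a * b ℤ.≤ a′ * b
*-monoʳ-≤ {b = b} 0≤b = ℤP.*-monoʳ-≤-nonNeg b ⦃ ℤ.nonNegative 0≤b ⦄

*-monoˡ-≤ : ∀ {a b b′} → 0ℤ ℤ.≤ a → b ℤ.≤ b′ → a * b ℤ.≤ a * b′
*-monoˡ-≤ {a = a} 0≤a = ℤP.*-monoˡ-≤-nonNeg a ⦃ ℤ.nonNegative 0≤a ⦄

*-nonneg : ∀ {a b} → 0ℤ ℤ.≤ a → 0ℤ ℤ.≤ b → 0ℤ ℤ.≤ a * b
*-nonneg 0≤a 0≤b = *-monoʳ-≤ 0≤b 0≤a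

j≤i*j : ∀ {i j} → 1ℤ ℤ.≤ i → 0ℤ ℤ.≤ j → j ℤ.≤ i * j
j≤i*j {i} {j} 1≤i 0≤j = subst (ℤ._≤ i * j) (ℤP.*-identityˡ j) (*-monoʳ-≤ 0≤j 1≤i)

⊗-nonneg : ∀ X Y → NonNegCoeffs X → NonNegCoeffs Y → NonNegCoeffs (X ⊗ Y)
⊗-nonneg X Y X≥0 Y≥0 n = subst (0ℤ ℤ.≤_) (sym (coeff-⊗ X Y ℕP.≤-refl n))
  (conv-nonneg (radius X) (coeff X) (coeff Y) n (λ i → *-nonneg (X≥0 i) (Y≥0 (n - i))))

⊗-monoˡ-≼ : ∀ X X′ Y → NonNegCoeffs Y → X ≼ X′ → X ⊗ Y ≼ X′ ⊗ Y
⊗-monoˡ-≼ X X′ Y Y≥0 X≼X′ n =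
  subst₂ ℤ._≤_ (sym (coeff-⊗ X Y (ℕP.m≤m+n (radius X) (radius X′)) n))
               (sym (coeff-⊗ X′ Y (ℕP.m≤n+m (radius X′) (radius X)) n))
    (conv-mono-≤ (radius X ℕ.+ radius X′) (coeff X) (coeff X′) (coeff Y) (coeff Y) n
      (λ i → *-monoʳ-≤ (Y≥0 (n - i)) (X≼X′ i)))

⊗-monoʳ-≼ : ∀ X Y Y′ → NonNegCoeffs X → Y ≼ Y′ → X ⊗ Y ≼ X ⊗ Y′
⊗-monoʳ-≼ X Y Y′ X≥0 Y≼Y′ n =
  subst₂ ℤ._≤_ (sym (coeff-⊗ X Y ℕP.≤-refl n)) (sym (coeff-⊗ X Y′ ℕP.≤-refl n))
    (conv-mono-≤ (radius X) (coeff X) (coeff X) (coeff Y) (coeff Y′) n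
      (λ i → *-monoˡ-≤ (X≥0 i) (Y≼Y′ (n - i))))

⊗-distribʳ : ∀ X A A′ Y → (∀ i → coeff X i ≡ coeff A i + coeff A′ i) →
             ∀ n → coeff (X ⊗ Y) n ≡ coeff (A ⊗ Y) n + coeff (A′ ⊗ Y) n
⊗-distribʳ X A A′ Y X≡A+A′ n = begin
  coeff (X ⊗ Y) n                  ≡⟨ coeff-⊗ X Y (ℕP.m≤m+n (radius X) _) n ⟩
  conv B (coeff X) (coeff Y) n     ≡⟨ conv-distribˡ B (coeff X) (coeff A) (coeff A′) (coeff Y) n X≡A+A′ ⟩
  conv B (coeff A) (coeff Y) n + conv B (coeff A′) (coeff Y) n
                                   ≡⟨ cong₂ _+_ (coeff-⊗ A Y A≤B n) (coeff-⊗ A′ Y A′≤B n) ⟨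
  coeff (A ⊗ Y) n + coeff (A′ ⊗ Y) n ∎
  where
  open ≡-Reasoning
  B = radius X ℕ.+ (radius A ℕ.+ radius A′)
  A≤B : radius A ℕ.≤ B
  A≤B = ℕP.≤-trans (ℕP.m≤m+n (radius A) (radius A′)) (ℕP.m≤n+m _ (radius X))
  A′≤B : radius A′ ℕ.≤ B
  A′≤B = ℕP.≤-trans (ℕP.m≤n+m (radius A′) (radius A)) (ℕP.m≤n+m _ (radius X))

coeff-*-≤-⊗ : ∀ X Y → NonNegCoeffs X → NonNegCoeffs Y →
              ∀ i j → coeff X i * coeff Y j ℤ.≤ coeff (X ⊗ Y) (i + j)
coeff-*-≤-⊗ X Y X≥0 Y≥0 i j with coeff X i ℤP.≟ 0ℤ
... | yes Xi≡0 = subst (λ x → x * coeff Y j ℤ.≤ coeff (X ⊗ Y) (i + j)) (sym Xi≡0)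
                   (⊗-nonneg X Y X≥0 Y≥0 (i + j))
... | no  Xi≢0 = begin
  coeff X i * coeff Y j                        ≡⟨ cong (λ k → coeff X i * coeff Y k) (cancel i j) ⟨
  coeff X i * coeff Y (i + j - i)              ≤⟨ term≤conv (radius X) (coeff X) (coeff Y) (i + j) i
                                                    (coeff-support X i Xi≢0) (λ k → *-nonneg (X≥0 k) (Y≥0 (i + j - k))) ⟩
  conv (radius X) (coeff X) (coeff Y) (i + j)  ≡⟨ coeff-⊗ X Y ℕP.≤-refl (i + j) ⟨
  coeff (X ⊗ Y) (i + j)                        ∎
  where
  open ℤP.≤-Reasoning
  cancel : ∀ i j → i + j - i ≡ j
  cancel = solve-∀

coeff-≤-⊗ˡ : ∀ X Y → NonNegCoeffs X → NonNegCoeffs Y →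
             ∀ i j → 1ℤ ℤ.≤ coeff X i → coeff Y j ℤ.≤ coeff (X ⊗ Y) (i + j)
coeff-≤-⊗ˡ X Y X≥0 Y≥0 i j 1≤Xi = ℤP.≤-trans (j≤i*j 1≤Xi (Y≥0 j)) (coeff-*-≤-⊗ X Y X≥0 Y≥0 i j)

coeff-≤-⊗ʳ : ∀ X Y → NonNegCoeffs X → NonNegCoeffs Y →
             ∀ i j → 1ℤ ℤ.≤ coeff Y j → coeff X i ℤ.≤ coeff (X ⊗ Y) (i + j)
coeff-≤-⊗ʳ X Y X≥0 Y≥0 i j 1≤Yj =
  ℤP.≤-trans (subst (coeff X i ℤ.≤_) (ℤP.*-comm (coeff Y j) (coeff X i)) (j≤i*j 1≤Yj (X≥0 i)))
             (coeff-*-≤-⊗ X Y X≥0 Y≥0 i j)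

product-term≡0 : ∀ X Y {a b} → DegreeAtMost X a → DegreeAtMost Y b →
                 ∀ n i → a ℤ.< i ⊎ b ℤ.< n - i → coeff X i * coeff Y (n - i) ≡ 0ℤ
product-term≡0 X Y X≤a Y≤b n i (inj₁ a<i)   =
  trans (cong (_* coeff Y (n - i)) (X≤a i a<i)) (ℤP.*-zeroˡ (coeff Y (n - i)))
product-term≡0 X Y X≤a Y≤b n i (inj₂ b<n-i) =
  trans (cong (coeff X i *_) (Y≤b (n - i) b<n-i)) (ℤP.*-zeroʳ (coeff X i))

⊗-degreeAtMost : ∀ X Y {a b} → DegreeAtMost X a → DegreeAtMost Y b → DegreeAtMost (X ⊗ Y) (a + b)
⊗-degreeAtMost X Y {a} {b} X≤a Y≤b n a+b<n =
  trans (coeff-⊗ X Y ℕP.≤-refl n) (conv-zero (radius X) (coeff X) (coeff Y) n term≡0)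
  where
  cancel : ∀ a b → a + b - a ≡ b
  cancel = solve-∀
  term≡0 : ∀ i → coeff X i * coeff Y (n - i) ≡ 0ℤ
  term≡0 i with a ℤP.<? i
  ... | yes a<i = product-term≡0 X Y X≤a Y≤b n i (inj₁ a<i)
  ... | no  a≮i = product-term≡0 X Y X≤a Y≤b n i (inj₂ (ℤP.<-≤-trans b<n-a n-a≤n-i))
    where
    b<n-a : b ℤ.< n - a
    b<n-a = subst (ℤ._< n - a) (cancel a b) (ℤP.+-monoˡ-< (- a) a+b<n)
    n-a≤n-i : n - a ℤ.≤ n - i
    n-a≤n-i = ℤP.+-monoʳ-≤ n (ℤP.neg-mono-≤ (ℤP.≮⇒≥ a≮i))

⊗-monicOfDegree : ∀ X Y {a b} → MonicOfDegree X a → MonicOfDegree Y b → MonicOfDegree (X ⊗ Y) (a + b)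
⊗-monicOfDegree X Y {a} {b} (Xa≡1 , X≤a) (Yb≡1 , Y≤b) = top≡1 , ⊗-degreeAtMost X Y X≤a Y≤b
  where
  cancel : ∀ a b → a + b - a ≡ b
  cancel = solve-∀
  term≡0 : ∀ i → i ≢ a → coeff X i * coeff Y (a + b - i) ≡ 0ℤ
  term≡0 i i≢a with ℤP.<-cmp i a
  ... | tri≈ _ i≡a _ = ⊥-elim (i≢a i≡a)
  ... | tri> _ _ a<i = product-term≡0 X Y X≤a Y≤b (a + b) i (inj₁ a<i)
  ... | tri< i<a _ _ = product-term≡0 X Y X≤a Y≤b (a + b) i
                         (inj₂ (subst (ℤ._< a + b - i) (cancel a b) (ℤP.+-monoʳ-< (a + b) (ℤP.neg-mono-< i<a))))
  Xa≢0 : coeff X a ≢ 0ℤ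
  Xa≢0 Xa≡0 with trans (sym Xa≡1) Xa≡0
  ... | ()
  top≡1 : coeff (X ⊗ Y) (a + b) ≡ 1ℤ
  top≡1 = begin
    coeff (X ⊗ Y) (a + b)                        ≡⟨ coeff-⊗ X Y ℕP.≤-refl (a + b) ⟩
    conv (radius X) (coeff X) (coeff Y) (a + b)  ≡⟨ conv-single (radius X) (coeff X) (coeff Y) (a + b) a
                                                      (coeff-support X a Xa≢0) term≡0 ⟩
    coeff X a * coeff Y (a + b - a)              ≡⟨ cong₂ (λ x k → x * coeff Y k) Xa≡1 (cancel a b) ⟩
    1ℤ * coeff Y b                               ≡⟨ ℤP.*-identityˡ (coeff Y b) ⟩
    coeff Y b                                    ≡⟨ Yb≡1 ⟩
    1ℤ                                           ∎
    where open ≡-Reasoning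

⊗-palindromic : ∀ X Y → Palindromic X → Palindromic Y → Palindromic (X ⊗ Y)
⊗-palindromic X Y X-pal Y-pal n = begin
  coeff (X ⊗ Y) (- n)                              ≡⟨ coeff-⊗ X Y ℕP.≤-refl (- n) ⟩
  conv (radius X) (coeff X) (coeff Y) (- n)        ≡⟨ conv-reflect (radius X) (coeff X) (coeff Y) n ⟩
  conv (radius X) (coeff X ∘ -_) (coeff Y ∘ -_) n  ≡⟨ conv-cong (radius X) n X-pal Y-pal ⟩
  conv (radius X) (coeff X) (coeff Y) n            ≡⟨ coeff-⊗ X Y ℕP.≤-refl n ⟨
  coeff (X ⊗ Y) n                                  ∎
  where open ≡-Reasoning

≼-degreeAtMost : ∀ D E {N} → NonNegCoeffs D → D ≼ E → DegreeAtMost E N → DegreeAtMost D N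
≼-degreeAtMost D E D≥0 D≼E E≤N n N<n = ℤP.≤-antisym (subst (coeff D n ℤ.≤_) (E≤N n N<n) (D≼E n)) (D≥0 n)

⊕⊖-monicOfDegree : ∀ P D {M N} → MonicOfDegree P N → DegreeAtMost D M → M ℤ.< N →
                   MonicOfDegree (P ⊕ (⊖ D)) N
⊕⊖-monicOfDegree P D {M} {N} (PN≡1 , P≤N) D≤M M<N = top≡1 , above≡0
  where
  top≡1 : coeff (P ⊕ (⊖ D)) N ≡ 1ℤ
  top≡1 = trans (coeff-⊕⊖ P D N) (cong₂ _-_ PN≡1 (D≤M N M<N))
  above≡0 : DegreeAtMost (P ⊕ (⊖ D)) N
  above≡0 n N<n = trans (coeff-⊕⊖ P D n) (cong₂ _-_ (P≤N n N<n) (D≤M n (ℤP.<-trans M<N N<n)))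

monicOfDegree-palindromic-bottom : ∀ p {N} → MonicOfDegree p N → Palindromic p → coeff p (- N) ≡ 1ℤ
monicOfDegree-palindromic-bottom p {N} (pN≡1 , _) p-pal = trans (p-pal N) pN≡1

nonneg-L : ∀ d cs → All (0ℤ ℤ.≤_) cs → NonNegCoeffs (L d cs)
nonneg-L d cs cs≥0 n = subst (0ℤ ℤ.≤_) (sym (coeff-L d cs n)) (nthℤ-nonneg (n - d))
  where
  nth-nonneg : ∀ {cs} → All (0ℤ ℤ.≤_) cs → ∀ k → 0ℤ ℤ.≤ nth cs k
  nth-nonneg []         _       = ℤP.≤-refl
  nth-nonneg (c≥0 ∷ _)  zero    = c≥0
  nth-nonneg (_ ∷ cs≥0) (suc k) = nth-nonneg cs≥0 k
  nthℤ-nonneg : ∀ k → 0ℤ ℤ.≤ nthℤ cs k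
  nthℤ-nonneg (+ k)    = nth-nonneg cs≥0 k
  nthℤ-nonneg -[1+ _ ] = ℤP.≤-refl

degreeAtMost-L : ∀ d cs N → d + + length cs ≡ 1ℤ + N → DegreeAtMost (L d cs) N
degreeAtMost-L d cs N d+len≡1+N n N<n =
  coeff-≥high d cs n (subst (ℤ._≤ n) (sym d+len≡1+N) (ℤP.i<j⇒suc[i]≤j N<n))

palindromic-oneL : Palindromic oneL
palindromic-oneL n = trans (coeff-L 0ℤ _ (- n)) (trans (centred n) (sym (coeff-L 0ℤ _ n)))
  where
  centred : ∀ n → nthℤ (+ 1 ∷ []) (- n - 0ℤ) ≡ nthℤ (+ 1 ∷ []) (n - 0ℤ)
  centred (+ 0)     = refl
  centred (+ suc _) = refl
  centred -[1+ _ ]  = refl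

palindromic-L₋₁ : ∀ x y → Palindromic (L -[1+ 0 ] (x ∷ y ∷ x ∷ []))
palindromic-L₋₁ x y n = trans (coeff-L -[1+ 0 ] _ (- n)) (trans (centred n) (sym (coeff-L -[1+ 0 ] _ n)))
  where
  centred : ∀ n → nthℤ (x ∷ y ∷ x ∷ []) (- n + 1ℤ) ≡ nthℤ (x ∷ y ∷ x ∷ []) (n + 1ℤ)
  centred (+ 0)                 = refl
  centred (+ 1)                 = refl
  centred (+ 2)                 = refl
  centred (+ suc (suc (suc _))) = refl
  centred -[1+ 0 ]              = refl
  centred -[1+ 1 ]              = refl
  centred -[1+ suc (suc _) ]    = refl

0≤1 : 0ℤ ℤ.≤ 1ℤ
0≤1 = ℤ.+≤+ z≤n

1+q⁻¹ : Laurent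
1+q⁻¹ = L -[1+ 0 ] (+ 1 ∷ + 1 ∷ [])

q : Laurent
q = L (+ 1) (+ 1 ∷ [])

q≥0 : NonNegCoeffs q
q≥0 = nonneg-L (+ 1) _ (0≤1 ∷ [])

1+q⁻¹≥0 : NonNegCoeffs 1+q⁻¹
1+q⁻¹≥0 = nonneg-L -[1+ 0 ] _ (0≤1 ∷ 0≤1 ∷ [])

1+q⁻¹-degreeAtMost : DegreeAtMost 1+q⁻¹ 0ℤ
1+q⁻¹-degreeAtMost = degreeAtMost-L -[1+ 0 ] _ 0ℤ refl

q⁻¹[3]-monicOfDegree : MonicOfDegree q⁻¹[3] 1ℤ
q⁻¹[3]-monicOfDegree = refl , degreeAtMost-L -[1+ 0 ] _ 1ℤ refl

q⁻¹[3]-palindromic : Palindromic q⁻¹[3]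
q⁻¹[3]-palindromic = palindromic-L₋₁ (+ 1) (+ 1)

q⁻¹[3]-split : ∀ i → coeff q⁻¹[3] i ≡ coeff 1+q⁻¹ i + coeff q i
q⁻¹[3]-split i = begin
  coeff q⁻¹[3] i                           ≡⟨ coeff-L -[1+ 0 ] _ i ⟩
  nthℤ (+ 1 ∷ + 1 ∷ + 1 ∷ []) (i + 1ℤ)    ≡⟨ split (i + 1ℤ) ⟩
  nthℤ (+ 1 ∷ + 1 ∷ []) (i + 1ℤ) + nthℤ (+ 1 ∷ []) (i + 1ℤ - + 2)
    ≡⟨ cong₂ _+_ (coeff-L -[1+ 0 ] _ i) (trans (coeff-L (+ 1) _ i) (cong (nthℤ (+ 1 ∷ [])) (shift i))) ⟨
  coeff 1+q⁻¹ i + coeff q i                ∎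
  where
  open ≡-Reasoning
  shift : ∀ i → i - 1ℤ ≡ i + 1ℤ - + 2
  shift = solve-∀
  split : ∀ k → nthℤ (+ 1 ∷ + 1 ∷ + 1 ∷ []) k ≡ nthℤ (+ 1 ∷ + 1 ∷ []) k + nthℤ (+ 1 ∷ []) (k - + 2)
  split (+ 0)                 = refl
  split (+ 1)                 = refl
  split (+ 2)                 = refl
  split (+ suc (suc (suc _))) = refl
  split -[1+ _ ]              = refl

record Admissible (p : Laurent) : Set where
  field
    nonneg      : NonNegCoeffs p
    monic       : Monic p
    palindromic : Palindromic p

oneL-admissible : Admissible oneL
oneL-admissible = record
  { nonneg      = nonneg-L 0ℤ _ (0≤1 ∷ [])
  ; monic       = 0ℤ , refl , degreeAtMost-L 0ℤ _ 0ℤ refl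
  ; palindromic = palindromic-oneL
  }

qPlusQinv-admissible : Admissible qPlusQinv
qPlusQinv-admissible = record
  { nonneg      = nonneg-L -[1+ 0 ] _ (0≤1 ∷ ℤP.≤-refl ∷ 0≤1 ∷ [])
  ; monic       = 1ℤ , refl , degreeAtMost-L -[1+ 0 ] _ 1ℤ refl
  ; palindromic = palindromic-L₋₁ (+ 1) (+ 0)
  }

record FareyInvariant (ml mr md : Laurent) : Set where
  field
    left             : Admissible ml
    right            : Admissible mr
    diff-nonneg      : NonNegCoeffs md
    diff-palindromic : Palindromic md
    diff-bound       : md ≼ (1+q⁻¹ ⊗ ml) ⊗ mr

module Mediant {ml mr md : Laurent} (I : FareyInvariant ml mr md) where

  open FareyInvariant I
  open Admissible left  using () renaming (nonneg to ml≥0; palindromic to ml-pal)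
  open Admissible right using () renaming (nonneg to mr≥0; palindromic to mr-pal)

  a b : ℤ
  a = proj₁ (Admissible.monic left)
  b = proj₁ (Admissible.monic right)

  ml-monic : MonicOfDegree ml a
  ml-monic = proj₂ (Admissible.monic left)

  mr-monic : MonicOfDegree mr b
  mr-monic = proj₂ (Admissible.monic right)

  m full lower upper : Laurent
  m     = step ml mr md
  full  = (q⁻¹[3] ⊗ ml) ⊗ mr
  lower = (1+q⁻¹ ⊗ ml) ⊗ mr
  upper = (q ⊗ ml) ⊗ mr

  upper≥0 : NonNegCoeffs upper
  upper≥0 = ⊗-nonneg (q ⊗ ml) mr (⊗-nonneg q ml q≥0 ml≥0) mr≥0

  coeff-m : ∀ n → coeff m n ≡ coeff lower n + coeff upper n - coeff md n
  coeff-m n = begin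
    coeff m n                                    ≡⟨ coeff-⊕⊖ full md n ⟩
    coeff full n - coeff md n                    ≡⟨ cong (_- coeff md n) (⊗-distribʳ _ _ _ mr q⁻¹[3]⊗ml-split n) ⟩
    coeff lower n + coeff upper n - coeff md n   ∎
    where
    open ≡-Reasoning
    q⁻¹[3]⊗ml-split : ∀ i → coeff (q⁻¹[3] ⊗ ml) i ≡ coeff (1+q⁻¹ ⊗ ml) i + coeff (q ⊗ ml) i
    q⁻¹[3]⊗ml-split = ⊗-distribʳ q⁻¹[3] 1+q⁻¹ q ml q⁻¹[3]-split

  upper≼m : upper ≼ m
  upper≼m n = begin
    coeff upper n                                ≡⟨ ℤP.+-identityʳ (coeff upper n) ⟨
    coeff upper n + 0ℤ                           ≤⟨ ℤP.+-monoʳ-≤ (coeff upper n) lower-md≥0 ⟩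
    coeff upper n + (coeff lower n - coeff md n) ≡⟨ rearrange (coeff lower n) (coeff upper n) (coeff md n) ⟩
    coeff lower n + coeff upper n - coeff md n   ≡⟨ coeff-m n ⟨
    coeff m n                                    ∎
    where
    open ℤP.≤-Reasoning
    rearrange : ∀ l u d → u + (l - d) ≡ l + u - d
    rearrange = solve-∀
    lower-md≥0 : 0ℤ ℤ.≤ coeff lower n - coeff md n
    lower-md≥0 = ℤP.i≤j⇒0≤j-i (diff-bound n)

  m-nonneg : NonNegCoeffs m
  m-nonneg n = ℤP.≤-trans (upper≥0 n) (upper≼m n)

  m-palindromic : Palindromic m
  m-palindromic n = begin
    coeff m (- n)                        ≡⟨ coeff-⊕⊖ full md (- n) ⟩
    coeff full (- n) - coeff md (- n)    ≡⟨ cong₂ _-_ (full-pal n) (diff-palindromic n) ⟩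
    coeff full n - coeff md n            ≡⟨ coeff-⊕⊖ full md n ⟨
    coeff m n                            ∎
    where
    open ≡-Reasoning
    full-pal : Palindromic full
    full-pal = ⊗-palindromic (q⁻¹[3] ⊗ ml) mr
              (⊗-palindromic q⁻¹[3] ml q⁻¹[3]-palindromic ml-pal) mr-pal

  m-monic : MonicOfDegree m (1ℤ + a + b)
  m-monic = ⊕⊖-monicOfDegree full md full-monic md≤a+b a+b<1+a+b
    where
    full-monic : MonicOfDegree full (1ℤ + a + b)
    full-monic = ⊗-monicOfDegree (q⁻¹[3] ⊗ ml) mr
                (⊗-monicOfDegree q⁻¹[3] ml q⁻¹[3]-monicOfDegree ml-monic) mr-monic
    lower≤a+b : DegreeAtMost lower (0ℤ + a + b)
    lower≤a+b = ⊗-degreeAtMost (1+q⁻¹ ⊗ ml) mr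
                  (⊗-degreeAtMost 1+q⁻¹ ml 1+q⁻¹-degreeAtMost (proj₂ ml-monic)) (proj₂ mr-monic)
    md≤a+b : DegreeAtMost md (0ℤ + a + b)
    md≤a+b = ≼-degreeAtMost md lower diff-nonneg diff-bound lower≤a+b
    a+b<1+a+b : 0ℤ + a + b ℤ.< 1ℤ + a + b
    a+b<1+a+b = ℤP.+-monoˡ-< b (ℤP.+-monoˡ-< a (ℤ.+<+ (s≤s z≤n)))

  m-admissible : Admissible m
  m-admissible = record { nonneg = m-nonneg ; monic = 1ℤ + a + b , m-monic ; palindromic = m-palindromic }

  ml-top : 1ℤ ℤ.≤ coeff ml a
  ml-top = ℤP.≤-reflexive (sym (proj₁ ml-monic))

  ml-bottom : 1ℤ ℤ.≤ coeff ml (- a)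
  ml-bottom = ℤP.≤-reflexive (sym (monicOfDegree-palindromic-bottom ml ml-monic ml-pal))

  mr-top : 1ℤ ℤ.≤ coeff mr b
  mr-top = ℤP.≤-reflexive (sym (proj₁ mr-monic))

  mr-bottom : 1ℤ ℤ.≤ coeff mr (- b)
  mr-bottom = ℤP.≤-reflexive (sym (monicOfDegree-palindromic-bottom mr mr-monic mr-pal))

  left-bound : mr ≼ (1+q⁻¹ ⊗ ml) ⊗ m
  left-bound n = begin
    coeff mr n
      ≤⟨ coeff-≤-⊗ˡ (q ⊗ ml) mr q⊗ml≥0 mr≥0 (1ℤ + a) n q⊗ml-top ⟩
    coeff upper (1ℤ + a + n)
      ≤⟨ coeff-≤-⊗ˡ (1+q⁻¹ ⊗ ml) upper 1+q⁻¹⊗ml≥0 upper≥0 (- 1ℤ - a) (1ℤ + a + n) 1+q⁻¹⊗ml-bottom ⟩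
    coeff ((1+q⁻¹ ⊗ ml) ⊗ upper) (- 1ℤ - a + (1ℤ + a + n))
      ≡⟨ cong (coeff ((1+q⁻¹ ⊗ ml) ⊗ upper)) (cancel a n) ⟩
    coeff ((1+q⁻¹ ⊗ ml) ⊗ upper) n
      ≤⟨ ⊗-monoʳ-≼ (1+q⁻¹ ⊗ ml) upper m 1+q⁻¹⊗ml≥0 upper≼m n ⟩
    coeff ((1+q⁻¹ ⊗ ml) ⊗ m) n
      ∎
    where
    open ℤP.≤-Reasoning
    cancel : ∀ a n → - 1ℤ - a + (1ℤ + a + n) ≡ n
    cancel = solve-∀
    q⊗ml≥0 : NonNegCoeffs (q ⊗ ml)
    q⊗ml≥0 = ⊗-nonneg q ml q≥0 ml≥0
    1+q⁻¹⊗ml≥0 : NonNegCoeffs (1+q⁻¹ ⊗ ml)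
    1+q⁻¹⊗ml≥0 = ⊗-nonneg 1+q⁻¹ ml 1+q⁻¹≥0 ml≥0
    q⊗ml-top : 1ℤ ℤ.≤ coeff (q ⊗ ml) (1ℤ + a)
    q⊗ml-top = ℤP.≤-trans ml-top (coeff-≤-⊗ˡ q ml q≥0 ml≥0 1ℤ a ℤP.≤-refl)
    1+q⁻¹⊗ml-bottom : 1ℤ ℤ.≤ coeff (1+q⁻¹ ⊗ ml) (- 1ℤ - a)
    1+q⁻¹⊗ml-bottom = ℤP.≤-trans ml-bottom (coeff-≤-⊗ˡ 1+q⁻¹ ml 1+q⁻¹≥0 ml≥0 (- 1ℤ) (- a) ℤP.≤-refl)

  right-bound : ml ≼ (1+q⁻¹ ⊗ m) ⊗ mr
  right-bound n = begin
    coeff ml n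
      ≤⟨ coeff-≤-⊗ˡ q ml q≥0 ml≥0 1ℤ n ℤP.≤-refl ⟩
    coeff (q ⊗ ml) (1ℤ + n)
      ≤⟨ coeff-≤-⊗ʳ (q ⊗ ml) mr q⊗ml≥0 mr≥0 (1ℤ + n) b mr-top ⟩
    coeff upper (1ℤ + n + b)
      ≤⟨ coeff-≤-⊗ˡ 1+q⁻¹ upper 1+q⁻¹≥0 upper≥0 (- 1ℤ) (1ℤ + n + b) ℤP.≤-refl ⟩
    coeff (1+q⁻¹ ⊗ upper) (- 1ℤ + (1ℤ + n + b))
      ≤⟨ coeff-≤-⊗ʳ (1+q⁻¹ ⊗ upper) mr 1+q⁻¹⊗upper≥0 mr≥0 (- 1ℤ + (1ℤ + n + b)) (- b) mr-bottom ⟩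
    coeff ((1+q⁻¹ ⊗ upper) ⊗ mr) (- 1ℤ + (1ℤ + n + b) - b)
      ≡⟨ cong (coeff ((1+q⁻¹ ⊗ upper) ⊗ mr)) (cancel n b) ⟩
    coeff ((1+q⁻¹ ⊗ upper) ⊗ mr) n
      ≤⟨ ⊗-monoˡ-≼ (1+q⁻¹ ⊗ upper) (1+q⁻¹ ⊗ m) mr mr≥0 1+q⁻¹⊗upper≼1+q⁻¹⊗m n ⟩
    coeff ((1+q⁻¹ ⊗ m) ⊗ mr) n
      ∎
    where
    open ℤP.≤-Reasoning
    cancel : ∀ n b → - 1ℤ + (1ℤ + n + b) - b ≡ n
    cancel = solve-∀
    q⊗ml≥0 : NonNegCoeffs (q ⊗ ml)
    q⊗ml≥0 = ⊗-nonneg q ml q≥0 ml≥0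
    1+q⁻¹⊗upper≥0 : NonNegCoeffs (1+q⁻¹ ⊗ upper)
    1+q⁻¹⊗upper≥0 = ⊗-nonneg 1+q⁻¹ upper 1+q⁻¹≥0 upper≥0
    1+q⁻¹⊗upper≼1+q⁻¹⊗m : 1+q⁻¹ ⊗ upper ≼ 1+q⁻¹ ⊗ m
    1+q⁻¹⊗upper≼1+q⁻¹⊗m = ⊗-monoʳ-≼ 1+q⁻¹ upper m 1+q⁻¹≥0 upper≼m

  invariant-left : FareyInvariant ml m mr
  invariant-left = record
    { left = left ; right = m-admissible ; diff-nonneg = mr≥0 ; diff-palindromic = mr-pal ; diff-bound = left-bound }

  invariant-right : FareyInvariant m mr ml
  invariant-right = record
    { left = m-admissible ; right = right ; diff-nonneg = ml≥0 ; diff-palindromic = ml-pal ; diff-bound = right-bound }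

initial-invariant : FareyInvariant oneL qPlusQinv oneL
initial-invariant = record
  { left             = oneL-admissible
  ; right            = qPlusQinv-admissible
  ; diff-nonneg      = Admissible.nonneg oneL-admissible
  ; diff-palindromic = Admissible.palindromic oneL-admissible
  ; diff-bound       = oneL≼bound
  }
  where
  bound : Laurent
  bound = (1+q⁻¹ ⊗ oneL) ⊗ qPlusQinv
  bound≥0 : NonNegCoeffs bound
  bound≥0 = ⊗-nonneg (1+q⁻¹ ⊗ oneL) qPlusQinv
              (⊗-nonneg 1+q⁻¹ oneL 1+q⁻¹≥0 (Admissible.nonneg oneL-admissible))
              (Admissible.nonneg qPlusQinv-admissible)
  oneL≼bound : oneL ≼ bound
  oneL≼bound n with n ℤP.≟ 0ℤ
  ... | yes refl = ℤP.≤-refl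
  ... | no  n≢0  = subst (ℤ._≤ coeff bound n) (sym (coeff-monomial-≢ 0ℤ (+ 1) n n≢0)) (bound≥0 n)

if-preserves : ∀ {A : Set} (P : A → Set) b {x y} → P x → P y → P (if b then x else y)
if-preserves P true  Px _  = Px
if-preserves P false _  Py = Py

go-admissible : ∀ fuel a b r s r′ s′ ml mr md → FareyInvariant ml mr md →
                Admissible (go fuel a b r s r′ s′ ml mr md)
go-admissible zero    _ _ _ _ _  _  _  _  _  _ = oneL-admissible
go-admissible (suc f) a b r s r′ s′ ml mr md I =
  if-preserves Admissible ⌊ a ℕ.* (s ℕ.+ s′) ℕ.≟ b ℕ.* (r ℕ.+ r′) ⌋ (Mediant.m-admissible I)
    (if-preserves Admissible ⌊ a ℕ.* (s ℕ.+ s′) ℕ.<? b ℕ.* (r ℕ.+ r′) ⌋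
      (go-admissible f a b r s (r ℕ.+ r′) (s ℕ.+ s′) ml (step ml mr md) mr (Mediant.invariant-left I))
      (go-admissible f a b (r ℕ.+ r′) (s ℕ.+ s′) r′ s′ (step ml mr md) mr ml (Mediant.invariant-right I)))

markovℕ-admissible : ∀ a b → Admissible (markovℕ a b)
markovℕ-admissible zero    b = oneL-admissible
markovℕ-admissible (suc a) b =
  if-preserves Admissible ⌊ suc a ℕ.≟ b ⌋ qPlusQinv-admissible
    (go-admissible b (suc a) b 0 1 1 1 oneL qPlusQinv oneL initial-invariant)

qMarkov-admissible : ∀ t → Admissible (qMarkov t)
qMarkov-admissible t with ↥ t
... | + a      = markovℕ-admissible a (↧ₙ t)
... | -[1+ _ ] = oneL-admissible

-- The bounds on t are not needed: the junk values of qMarkov (for negative t, or when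
-- the fuel of `go` runs out) are 1, which is admissible too.
corollary1p5 : ∀ (t : ℚ) → 0ℚ ≤ t → t ≤ 1ℚ →
    NonNegCoeffs (qMarkov t) × Monic (qMarkov t) × Palindromic (qMarkov t)
corollary1p5 t _ _ = nonneg , monic , palindromic
  where open Admissible (qMarkov-admissible t)
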